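{- Let $h\geq 3$ be an integer. Let $A=\{a_1,a_2,\ldots,a_{h+1}\}$ be a set of nonnegative integers such that $0=a_1<a_2<\cdots<a_{h+1}$. Assume that $a_3\not\equiv 0\pmod 2$ and $a_2\equiv 0\pmod 2$. Then \[ |h^{\wedge}_{\pm}A| \geq |h^{\wedge}_{\pm}A_3| + \frac{h(h+1)}{2} + h + 1, \] where $A_3=A\setminus\{a_3\}$. Hence $|h^{\wedge}_{\pm}A|\geq h^2+h+2$.
   Context: For a finite set $A=\{a_1,\ldots,a_k\}$ of integers and a positive integer $h$, the restricted $h$-fold signed sumset is $h^{\wedge}_{\pm}A=\left\{\sum_{i=1}^{k}\lambda_i a_i : \lambda_i\in\{ -1,0,1\} \text{ for all } i,\ \sum_{i=1}^{k}|\lambda_i| = h\right\}$. -}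

module Defs where

open import Data.Nat using (ℕ; zero; suc)
open import Data.Integer using (ℤ; +_; -_; _+_; _≟_)
open import Data.List using (List; []; _∷_; _++_; map; length; deduplicate)

-- All sums Σ λᵢ aᵢ with λᵢ ∈ {-1,0,1} and exactly h nonzero λᵢ
-- (as a list, possibly with repetitions).
signedSums : ℕ → List ℤ → List ℤ
signedSums zero    _        = (+ 0) ∷ []
signedSums (suc h) []       = []
signedSums (suc h) (a ∷ as) =
  signedSums (suc h) as ++ map (λ s → a + s) (signedSums h as) ++ map (λ s → (- a) + s) (signedSums h as)

restrSignedSumset : ℕ → List ℤ → List ℤ
restrSignedSumset h A = deduplicate _≟_ (signedSums h A)

card : ℕ → List ℕ → ℕ
card h A = length (restrSignedSumset h (map +_ A))

-- Write T n = n (n + 1) / 2. An h-term signed sum of A either omits a₃, and is then a signed sum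
-- of all of A₃ = A ∖ {a₃}, or uses a₃ and omits 0 or a₂. A signed sum of a list is congruent to
-- its plain sum mod 2, so with a₂ even and a₃ odd the two kinds never coincide. Sums of the
-- second kind are exhibited as an explicit increasing chain: taking the elements of {a₃} ∪ rest
-- in decreasing order d > ds, first come the sums with −d, then those with +d and one element of
-- ds negated, then those with everything positive; this yields 1 + T (h − 1) + 2h = T h + h + 1
-- distinct values. The same chain over the positive elements of A₃ gives |h^∧_± A₃| ≥ 1 + T (h − 1),
-- and T (h − 1) + T h = h² gives the second bound.
module Submission where

open import Defs
open import Data.Empty using (⊥-elim)
open import Data.Integer as ℤ using (ℤ; +_; -_; _+_; _-_; _*_; 0ℤ; _≟_; _≤_; _<_; _>_)
open import Data.Integer.Divisibility.Signed
  using (divides; ∣m∣n⇒∣m+n; ∣m∣n⇒∣m-n; ∣ᵤ⇒∣; ∣⇒∣ᵤ) renaming (_∣_ to _∣ℤ_)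
import Data.Integer.Properties as ℤ
open import Algebra.Properties.CommutativeSemigroup ℤ.+-commutativeSemigroup
  using () renaming (x∙yz≈y∙xz to exchange)
open import Data.Integer.Tactic.RingSolver using (solve-∀)
open import Data.List using (List; []; _∷_; _++_; map; foldr; length; reverse; deduplicate)
open import Data.List.Membership.Propositional using (_∈_)
open import Data.List.Membership.Propositional.Properties
  using (∈-map⁻; ∈-map⁺; ∈-++⁻; ∈-++⁺ˡ; ∈-++⁺ʳ; ∈-deduplicate⁻; ∈-deduplicate⁺)
open import Data.List.Properties
  using (length-++; length-map; length-reverse; length-removeAt′; unfold-reverse)
open import Data.List.Relation.Binary.Disjoint.Propositional using (Disjoint)
open import Data.List.Relation.Binary.Permutation.Propositional as ↭ using (_↭_)
open import Data.List.Relation.Binary.Permutation.Propositional.Properties using (↭-reverse; All-resp-↭)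
open import Data.List.Relation.Binary.Subset.Propositional using (_⊆_)
import Data.List.Relation.Binary.Subset.Propositional.Properties as ⊆
open import Data.List.Relation.Unary.All as All using (All; []; _∷_)
import Data.List.Relation.Unary.All.Properties as All
open import Data.List.Relation.Unary.AllPairs as AllPairs using (AllPairs; []; _∷_)
import Data.List.Relation.Unary.AllPairs.Properties as AllPairs
open import Data.List.Relation.Unary.Any using (here; there; index; _─_)
open import Data.List.Relation.Unary.Linked using (Linked)
open import Data.List.Relation.Unary.Linked.Properties using (Linked⇒AllPairs)
open import Data.List.Relation.Unary.Unique.Propositional using (Unique)
import Data.List.Relation.Unary.Unique.Propositional.Properties as Unique
open import Data.List.Relation.Unary.Unique.DecPropositional.Properties using (deduplicate-!)
open import Data.Nat as ℕ using (ℕ; zero; suc; z≤n; s≤s)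
open import Data.Nat.Divisibility using (_∣_)
open import Data.Nat.DivMod using (m*n/n≡m)
import Data.Nat.Properties as ℕ
open import Data.Nat.Tactic.RingSolver using () renaming (solve-∀ to ℕ-solve-∀)
open import Data.Product using (_×_; _,_; ∃₂; proj₁; proj₂)
open import Data.Sum using (_⊎_; inj₁; inj₂)
open import Function using (_∘_)
open import Relation.Binary.Definitions using (DecidableEquality)
open import Relation.Binary.PropositionalEquality
  using (_≡_; _≢_; refl; sym; cong; cong₂; subst; trans; module ≡-Reasoning)
open import Relation.Nullary using (¬_)

∈-─⁺ : ∀ {a} {A : Set a} {x z : A} {ys} (x∈ys : x ∈ ys) → z ∈ ys → z ≢ x → z ∈ (ys ─ x∈ys)
∈-─⁺ (here refl)  (here refl)  z≢x = ⊥-elim (z≢x refl)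
∈-─⁺ (here refl)  (there z∈ys) _   = z∈ys
∈-─⁺ (there x∈ys) (here refl)  _   = here refl
∈-─⁺ (there x∈ys) (there z∈ys) z≢x = there (∈-─⁺ x∈ys z∈ys z≢x)

unique-⊆⇒length-≤ : ∀ {a} {A : Set a} {xs ys : List A} → Unique xs → xs ⊆ ys → length xs ℕ.≤ length ys
unique-⊆⇒length-≤ {xs = []}     _             _         = z≤n
unique-⊆⇒length-≤ {xs = x ∷ xs} {ys} (x∉xs ∷ !xs) x∷xs⊆ys = begin
  suc (length xs)          ≤⟨ s≤s (unique-⊆⇒length-≤ !xs xs⊆ys─x) ⟩
  suc (length (ys ─ x∈ys)) ≡⟨ length-removeAt′ ys (index x∈ys) ⟨
  length ys                ∎
  where
  open ℕ.≤-Reasoning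
  x∈ys = x∷xs⊆ys (here refl)
  xs⊆ys─x : xs ⊆ (ys ─ x∈ys)
  xs⊆ys─x z∈xs = ∈-─⁺ x∈ys (x∷xs⊆ys (there z∈xs)) (λ z≡x → All.lookup x∉xs z∈xs (sym z≡x))

module _ {a} {A : Set a} (_≟ᴬ_ : DecidableEquality A) where

  length-deduplicate-++-≤ : ∀ {xs ys zs : List A} → Unique ys → Disjoint xs ys → xs ⊆ zs → ys ⊆ zs →
    length (deduplicate _≟ᴬ_ xs) ℕ.+ length ys ℕ.≤ length (deduplicate _≟ᴬ_ zs)
  length-deduplicate-++-≤ {xs} {ys} {zs} !ys xs#ys xs⊆zs ys⊆zs = begin
    length xs′ ℕ.+ length ys       ≡⟨ length-++ xs′ ⟨
    length (xs′ ++ ys)             ≤⟨ unique-⊆⇒length-≤ !xs′++ys xs′++ys⊆ ⟩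
    length (deduplicate _≟ᴬ_ zs)   ∎
    where
    open ℕ.≤-Reasoning
    xs′ = deduplicate _≟ᴬ_ xs
    !xs′++ys : Unique (xs′ ++ ys)
    !xs′++ys = Unique.++⁺ (deduplicate-! _≟ᴬ_ xs) !ys
      (λ (v∈xs′ , v∈ys) → xs#ys (∈-deduplicate⁻ _≟ᴬ_ xs v∈xs′ , v∈ys))
    xs′++ys⊆ : xs′ ++ ys ⊆ deduplicate _≟ᴬ_ zs
    xs′++ys⊆ v∈ with ∈-++⁻ xs′ v∈
    ... | inj₁ v∈xs′ = ∈-deduplicate⁺ _≟ᴬ_ (xs⊆zs (∈-deduplicate⁻ _≟ᴬ_ xs v∈xs′))
    ... | inj₂ v∈ys  = ∈-deduplicate⁺ _≟ᴬ_ (ys⊆zs v∈ys)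

All-reverse : ∀ {a p} {A : Set a} {P : A → Set p} {xs} → All P xs → All P (reverse xs)
All-reverse {xs = xs} = All-resp-↭ (↭.↭-sym (↭-reverse xs))

AllPairs-reverse : ∀ {a ℓ} {A : Set a} {R : A → A → Set ℓ} {xs} →
  AllPairs R xs → AllPairs (λ x y → R y x) (reverse xs)
AllPairs-reverse {xs = []}     []           = []
AllPairs-reverse {xs = x ∷ xs} (x∼xs ∷ xs!) rewrite unfold-reverse x xs =
  AllPairs.++⁺ (AllPairs-reverse xs!) ([] ∷ []) (All-reverse (All.map (_∷ []) x∼xs))

AllPairs-drop-third : ∀ {a ℓ} {A : Set a} {R : A → A → Set ℓ} {x y z zs} →
  AllPairs R (x ∷ y ∷ z ∷ zs) → AllPairs R (x ∷ y ∷ zs)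
AllPairs-drop-third ((Rxy ∷ _ ∷ Rxzs) ∷ (_ ∷ Ryzs) ∷ _ ∷ zs!) = (Rxy ∷ Rxzs) ∷ Ryzs ∷ zs!

total : List ℤ → ℤ
total = foldr _+_ 0ℤ

data SignedSum : List ℤ → ℤ → Set where
  []  : SignedSum [] 0ℤ
  +∷_ : ∀ {a xs y} → SignedSum xs y → SignedSum (a ∷ xs) (a + y)
  -∷_ : ∀ {a xs y} → SignedSum xs y → SignedSum (a ∷ xs) (- a + y)

SignedSum⇒∈signedSums : ∀ {xs y} → SignedSum xs y → y ∈ signedSums (length xs) xs
SignedSum⇒∈signedSums []                 = here refl
SignedSum⇒∈signedSums (+∷_ {a} {xs} p) =
  ∈-++⁺ʳ (signedSums (length (a ∷ xs)) xs) (∈-++⁺ˡ (∈-map⁺ (λ s → a + s) (SignedSum⇒∈signedSums p)))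
SignedSum⇒∈signedSums (-∷_ {a} {xs} p) =
  ∈-++⁺ʳ (signedSums (length (a ∷ xs)) xs)
    (∈-++⁺ʳ (map (λ s → a + s) (signedSums (length xs) xs)) (∈-map⁺ (λ s → - a + s) (SignedSum⇒∈signedSums p)))

signedSums-tooFew : ∀ k xs → length xs ℕ.< k → signedSums k xs ≡ []
signedSums-tooFew (suc k)       []       _          = refl
signedSums-tooFew (suc (suc k)) (a ∷ as) (s≤s |as|<k)
  rewrite signedSums-tooFew (suc (suc k)) as (ℕ.m<n⇒m<1+n |as|<k)
        | signedSums-tooFew (suc k) as |as|<k = refl

∈signedSums⇒SignedSum : ∀ xs {y} → y ∈ signedSums (length xs) xs → SignedSum xs y
∈signedSums⇒SignedSum []       (here refl) = []
∈signedSums⇒SignedSum (a ∷ as) y∈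
  with ∈-++⁻ (signedSums (length (a ∷ as)) as) y∈
... | inj₁ y∈′ rewrite signedSums-tooFew (length (a ∷ as)) as ℕ.≤-refl with y∈′
...   | ()
∈signedSums⇒SignedSum (a ∷ as) y∈ | inj₂ y∈′
  with ∈-++⁻ (map (λ s → a + s) (signedSums (length as) as)) y∈′
... | inj₁ y∈₊ with ∈-map⁻ (λ s → a + s) y∈₊
...   | s , s∈ , refl = +∷ ∈signedSums⇒SignedSum as s∈
∈signedSums⇒SignedSum (a ∷ as) y∈ | inj₂ y∈′ | inj₂ y∈₋ with ∈-map⁻ (λ s → - a + s) y∈₋
...   | s , s∈ , refl = -∷ ∈signedSums⇒SignedSum as s∈

SignedSum-resp-↭ : ∀ {xs ys y} → xs ↭ ys → SignedSum xs y → SignedSum ys y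
SignedSum-resp-↭ ↭.refl         p         = p
SignedSum-resp-↭ (↭.prep _ xs↭) (+∷ p)    = +∷ SignedSum-resp-↭ xs↭ p
SignedSum-resp-↭ (↭.prep _ xs↭) (-∷ p)    = -∷ SignedSum-resp-↭ xs↭ p
SignedSum-resp-↭ (↭.swap x y xs↭) (+∷ +∷ p) = subst (SignedSum _) (exchange y x _) (+∷ +∷ SignedSum-resp-↭ xs↭ p)
SignedSum-resp-↭ (↭.swap x y xs↭) (+∷ -∷ p) = subst (SignedSum _) (exchange (- y) x _) (-∷ +∷ SignedSum-resp-↭ xs↭ p)
SignedSum-resp-↭ (↭.swap x y xs↭) (-∷ +∷ p) = subst (SignedSum _) (exchange y (- x) _) (+∷ -∷ SignedSum-resp-↭ xs↭ p)
SignedSum-resp-↭ (↭.swap x y xs↭) (-∷ -∷ p) = subst (SignedSum _) (exchange (- y) (- x) _) (-∷ -∷ SignedSum-resp-↭ xs↭ p)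
SignedSum-resp-↭ (↭.trans xs↭ ↭ys) p      = SignedSum-resp-↭ ↭ys (SignedSum-resp-↭ xs↭ p)

SignedSum-parity : ∀ {xs y} → SignedSum xs y → + 2 ∣ℤ total xs - y
SignedSum-parity []                   = divides 0ℤ refl
SignedSum-parity (+∷_ {a} {xs} {y} p) = subst (+ 2 ∣ℤ_) (cancel a (total xs) y) (SignedSum-parity p)
  where
  cancel : ∀ a t y → t - y ≡ (a + t) - (a + y)
  cancel = solve-∀
SignedSum-parity (-∷_ {a} {xs} {y} p) =
  subst (+ 2 ∣ℤ_) (shift a (total xs) y) (∣m∣n⇒∣m+n (SignedSum-parity p) (divides a refl))
  where
  shift : ∀ a t y → (t - y) + a * + 2 ≡ (a + t) - (- a + y)
  shift = solve-∀

SignedSum-common⇒even : ∀ {xs ys u} → SignedSum xs u → SignedSum ys u → + 2 ∣ℤ total xs - total ys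
SignedSum-common⇒even {xs} {ys} {u} p q =
  subst (+ 2 ∣ℤ_) (cancel (total xs) (total ys) u) (∣m∣n⇒∣m-n (SignedSum-parity p) (SignedSum-parity q))
  where
  cancel : ∀ s t u → (s - u) - (t - u) ≡ s - t
  cancel = solve-∀

total-SignedSum : ∀ xs → SignedSum xs (total xs)
total-SignedSum []       = []
total-SignedSum (x ∷ xs) = +∷ total-SignedSum xs

negateOne-SignedSum : ∀ {e xs} → e ∈ xs → SignedSum xs (total xs - (e + e))
negateOne-SignedSum {e} {_ ∷ xs} (here refl) = subst (SignedSum _) (flip e (total xs)) (-∷ total-SignedSum xs)
  where
  flip : ∀ e t → - e + t ≡ (e + t) - (e + e)
  flip = solve-∀
negateOne-SignedSum {e} {a ∷ xs} (there e∈xs) =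
  subst (SignedSum _) (sym (ℤ.+-assoc a (total xs) (- (e + e)))) (+∷ negateOne-SignedSum e∈xs)

infix 4 _⊑_
_⊑_ : List ℤ → List ℤ → Set
xs ⊑ ys = ∀ k → signedSums k xs ⊆ signedSums k ys

xs⊑x∷xs : ∀ xs x → xs ⊑ x ∷ xs
xs⊑x∷xs xs x zero    = ⊆.⊆-refl
xs⊑x∷xs xs x (suc k) = ⊆.xs⊆xs++ys _ _

⊑-∷⁺ʳ : ∀ x {xs ys} → xs ⊑ ys → x ∷ xs ⊑ x ∷ ys
⊑-∷⁺ʳ x xs⊑ys zero    = ⊆.⊆-refl
⊑-∷⁺ʳ x xs⊑ys (suc k) = ⊆.++⁺ (xs⊑ys (suc k)) (⊆.++⁺ (⊆.map⁺ _ (xs⊑ys k)) (⊆.map⁺ _ (xs⊑ys k)))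

triangle : ℕ → ℕ
triangle zero    = 0
triangle (suc n) = suc n ℕ.+ triangle n

triangle-double : ∀ n → triangle n ℕ.* 2 ≡ n ℕ.* (n ℕ.+ 1)
triangle-double zero    = refl
triangle-double (suc n) = begin
  (suc n ℕ.+ triangle n) ℕ.* 2         ≡⟨ ℕ.*-distribʳ-+ 2 (suc n) (triangle n) ⟩
  suc n ℕ.* 2 ℕ.+ triangle n ℕ.* 2     ≡⟨ cong (suc n ℕ.* 2 ℕ.+_) (triangle-double n) ⟩
  suc n ℕ.* 2 ℕ.+ n ℕ.* (n ℕ.+ 1)      ≡⟨ expand n ⟩
  suc n ℕ.* (suc n ℕ.+ 1)              ∎
  where
  open ≡-Reasoning
  expand : ∀ n → suc n ℕ.* 2 ℕ.+ n ℕ.* (n ℕ.+ 1) ≡ suc n ℕ.* (suc n ℕ.+ 1)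
  expand = ℕ-solve-∀

triangle-half : ∀ n → n ℕ.* (n ℕ.+ 1) ℕ./ 2 ≡ triangle n
triangle-half n = trans (cong (ℕ._/ 2) (sym (triangle-double n))) (m*n/n≡m (triangle n) 2)

triangle+triangle : ∀ n → suc n ℕ.^ 2 ℕ.+ suc n ℕ.+ 2 ≡ suc (triangle n) ℕ.+ suc (triangle n ℕ.+ 2 ℕ.* suc n)
triangle+triangle n = begin
  suc n ℕ.^ 2 ℕ.+ suc n ℕ.+ 2               ≡⟨ expand n ⟩
  n ℕ.* (n ℕ.+ 1) ℕ.+ (2 ℕ.* suc n ℕ.+ 2)   ≡⟨ cong (ℕ._+ (2 ℕ.* suc n ℕ.+ 2)) (triangle-double n) ⟨
  triangle n ℕ.* 2 ℕ.+ (2 ℕ.* suc n ℕ.+ 2)  ≡⟨ regroup (triangle n) n ⟩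
  suc (triangle n) ℕ.+ suc (triangle n ℕ.+ 2 ℕ.* suc n) ∎
  where
  open ≡-Reasoning
  expand : ∀ n → suc n ℕ.* (suc n ℕ.* 1) ℕ.+ suc n ℕ.+ 2 ≡ n ℕ.* (n ℕ.+ 1) ℕ.+ (2 ℕ.* suc n ℕ.+ 2)
  expand = ℕ-solve-∀
  regroup : ∀ t n → t ℕ.* 2 ℕ.+ (2 ℕ.* suc n ℕ.+ 2) ≡ suc t ℕ.+ suc (t ℕ.+ 2 ℕ.* suc n)
  regroup = ℕ-solve-∀

-- For d ∷ ds its three blocks are
-- the sums with −d, those with +d and exactly one e ∈ ds negated (completed by m), and those with
-- all of d ∷ ds positive; they are increasing when ds is decreasing, base ⊆ [lo, m] and m − 2e < lo.
chain : List ℤ → ℤ → List ℤ → List ℤ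
chain base m []       = base
chain base m (d ∷ ds) =
  map (λ x → - d + x) (chain base m ds) ++
  map (λ e → (m - (e + e)) + (d + total ds)) ds ++
  map (λ b → b + (d + total ds)) base

∈-chain⁻ : ∀ {base m x} ds → m ∈ base → x ∈ chain base m ds →
  ∃₂ λ b y → b ∈ base × SignedSum ds y × x ≡ b + y
∈-chain⁻ {x = x} [] _ x∈base = x , 0ℤ , x∈base , [] , sym (ℤ.+-identityʳ x)
∈-chain⁻ {base} {m} (d ∷ ds) m∈base x∈
  with ∈-++⁻ (map (λ x → - d + x) (chain base m ds)) x∈
... | inj₁ x∈₋ with ∈-map⁻ _ x∈₋
...   | x′ , x′∈ , refl with ∈-chain⁻ ds m∈base x′∈
...     | b , y , b∈ , p , refl = b , - d + y , b∈ , -∷ p , exchange (- d) b y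
∈-chain⁻ {base} {m} (d ∷ ds) m∈base x∈ | inj₂ x∈′
  with ∈-++⁻ (map (λ e → (m - (e + e)) + (d + total ds)) ds) x∈′
... | inj₁ x∈flip with ∈-map⁻ _ x∈flip
...   | e , e∈ds , refl =
  m , _ , m∈base , negateOne-SignedSum (there e∈ds) , regroup m (e + e) (d + total ds)
  where
  regroup : ∀ m f t → (m - f) + t ≡ m + (t - f)
  regroup = solve-∀
∈-chain⁻ {base} {m} (d ∷ ds) m∈base x∈ | inj₂ x∈′ | inj₂ x∈top with ∈-map⁻ _ x∈top
...   | b , b∈ , refl = b , _ , b∈ , total-SignedSum (d ∷ ds) , refl

length-chain : ∀ b bs m ds →
  length (chain (b ∷ bs) m ds) ≡ suc (triangle (length ds) ℕ.+ length bs ℕ.* suc (length ds))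
length-chain b bs m []       = cong suc (sym (ℕ.*-identityʳ (length bs)))
length-chain b bs m (d ∷ ds) = begin
  length (negs ++ flips ++ tops)                              ≡⟨ length-++ negs ⟩
  length negs ℕ.+ length (flips ++ tops)                      ≡⟨ cong (length negs ℕ.+_) (length-++ flips) ⟩
  length negs ℕ.+ (length flips ℕ.+ length tops)
    ≡⟨ cong₂ ℕ._+_ (length-map _ (chain base m ds)) (cong₂ ℕ._+_ (length-map _ ds) (length-map _ base)) ⟩
  length (chain base m ds) ℕ.+ (n ℕ.+ suc B)                  ≡⟨ cong (ℕ._+ (n ℕ.+ suc B)) (length-chain b bs m ds) ⟩
  suc (triangle n ℕ.+ B ℕ.* suc n) ℕ.+ (n ℕ.+ suc B)          ≡⟨ rearrange (triangle n) n B ⟩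
  suc (triangle (suc n) ℕ.+ B ℕ.* suc (suc n))                ∎
  where
  open ≡-Reasoning
  base = b ∷ bs
  B = length bs
  n = length ds
  negs  = map (λ x → - d + x) (chain base m ds)
  flips = map (λ e → (m - (e + e)) + (d + total ds)) ds
  tops  = map (λ b → b + (d + total ds)) base
  rearrange : ∀ t n B → suc (t ℕ.+ B ℕ.* suc n) ℕ.+ (n ℕ.+ suc B) ≡ suc ((suc n ℕ.+ t) ℕ.+ B ℕ.* suc (suc n))
  rearrange = ℕ-solve-∀

-- The largest sum with −d is the one with only d negated.
neg-block-bound : ∀ d m S {x} → x ≤ m + S → - d + x ≤ (m - (d + d)) + (d + S)
neg-block-bound d m S {x} x≤ = begin
  - d + x               ≤⟨ ℤ.+-monoʳ-≤ (- d) x≤ ⟩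
  - d + (m + S)         ≡⟨ regroup d m S ⟩
  (m - (d + d)) + (d + S) ∎
  where
  open ℤ.≤-Reasoning
  regroup : ∀ d m S → - d + (m + S) ≡ (m - (d + d)) + (d + S)
  regroup = solve-∀

chain-≤ : ∀ {base m} ds → All (_≤ m) base → All (0ℤ ≤_) ds → All (_≤ m + total ds) (chain base m ds)
chain-≤ {m = m} [] b≤m _ = All.map (λ b≤ → ℤ.≤-trans b≤ (ℤ.≤-reflexive (sym (ℤ.+-identityʳ m)))) b≤m
chain-≤ {base} {m} (d ∷ ds) b≤m (0≤d ∷ 0≤ds) =
  All.++⁺ (All.map⁺ (All.map below-neg (chain-≤ ds b≤m 0≤ds)))
    (All.++⁺ (All.map⁺ (All.map below-flip 0≤ds)) (All.map⁺ (All.map (ℤ.+-monoˡ-≤ T) b≤m)))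
  where
  T = d + total ds
  below-flip : ∀ {e} → 0ℤ ≤ e → (m - (e + e)) + T ≤ m + T
  below-flip {e} 0≤e = ℤ.+-monoˡ-≤ T (ℤ.i-j≤i m (e + e) {{ℤ.nonNegative (ℤ.+-mono-≤ 0≤e 0≤e)}})
  below-neg : ∀ {x} → x ≤ m + total ds → - d + x ≤ m + T
  below-neg x≤ = ℤ.≤-trans (neg-block-bound d m (total ds) x≤) (below-flip 0≤d)

chain-sorted : ∀ {base m lo} ds → AllPairs _<_ base → All (λ b → lo ≤ b × b ≤ m) base →
  AllPairs _>_ ds → All (λ e → 0ℤ ≤ e × m - (e + e) < lo) ds → AllPairs _<_ (chain base m ds)
chain-sorted [] base↑ _ _ _ = base↑
chain-sorted {base} {m} {lo} (d ∷ ds) base↑ base⊆ (ds<d ∷ ds↓) ((_ , d-gap) ∷ ds-gap) =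
  AllPairs.++⁺ neg↑ (AllPairs.++⁺ flip↑ top↑ flip<top) neg<rest
  where
  T = d + total ds
  flipped : ℤ → ℤ
  flipped e = (m - (e + e)) + T
  flipped-mono : ∀ {e₁ e₂} → e₂ < e₁ → flipped e₁ < flipped e₂
  flipped-mono e₂<e₁ = ℤ.+-monoˡ-< T (ℤ.+-monoʳ-< m (ℤ.neg-mono-< (ℤ.+-mono-< e₂<e₁ e₂<e₁)))
  flipped<top : ∀ e {b} → m - (e + e) < lo → lo ≤ b × b ≤ m → flipped e < b + T
  flipped<top e gap (lo≤b , _) = ℤ.+-monoˡ-< T (ℤ.<-≤-trans gap lo≤b)
  negs = map (λ x → - d + x) (chain base m ds)
  tops = map (_+ T) base
  neg↑ : AllPairs _<_ negs
  neg↑ = AllPairs.map⁺ (AllPairs.map (ℤ.+-monoʳ-< (- d))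
           (chain-sorted ds base↑ base⊆ ds↓ ds-gap))
  flip↑ : AllPairs _<_ (map flipped ds)
  flip↑ = AllPairs.map⁺ (AllPairs.map flipped-mono ds↓)
  top↑ : AllPairs _<_ tops
  top↑ = AllPairs.map⁺ (AllPairs.map (ℤ.+-monoˡ-< T) base↑)
  flip<top : All (λ x → All (x <_) tops) (map flipped ds)
  flip<top = All.map⁺ (All.map (λ {e} (_ , gap) → All.map⁺ (All.map (flipped<top e gap) base⊆)) ds-gap)
  flipped-d<rest : All (flipped d <_) (map flipped ds ++ tops)
  flipped-d<rest = All.++⁺ (All.map⁺ (All.map flipped-mono ds<d))
                           (All.map⁺ (All.map (flipped<top d d-gap) base⊆))
  neg<rest : All (λ x → All (x <_) (map flipped ds ++ tops)) negs
  neg<rest = All.map⁺ (All.map (λ x≤ → All.map (ℤ.≤-<-trans (neg-block-bound d m (total ds) x≤)) flipped-d<rest)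
               (chain-≤ ds (All.map proj₂ base⊆) (All.map proj₁ ds-gap)))

m<e⇒m-[e+e]<-m : ∀ {m e} → m < e → m - (e + e) < - m
m<e⇒m-[e+e]<-m {m} {e} m<e = begin-strict
  m - (e + e) <⟨ ℤ.+-monoʳ-< m (ℤ.neg-mono-< (ℤ.+-mono-< m<e m<e)) ⟩
  m - (m + m) ≡⟨ cancel m ⟩
  - m         ∎
  where
  open ℤ.≤-Reasoning
  cancel : ∀ m → m - (m + m) ≡ - m
  cancel = solve-∀

triangle<restrSignedSumset : ∀ {xs} → AllPairs _<_ (0ℤ ∷ xs) →
  suc (triangle (length xs)) ℕ.≤ length (restrSignedSumset (length (0ℤ ∷ xs)) (0ℤ ∷ xs))
triangle<restrSignedSumset {xs} (0<xs ∷ xs↑) = begin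
  suc (triangle (length xs))                              ≡⟨ length-sums ⟨
  length sums                                             ≤⟨ unique-⊆⇒length-≤ (AllPairs.map ℤ.<⇒≢ sums↑) sums⊆ ⟩
  length (restrSignedSumset (length (0ℤ ∷ xs)) (0ℤ ∷ xs)) ∎
  where
  open ℕ.≤-Reasoning
  sums = chain (0ℤ ∷ []) 0ℤ (reverse xs)
  length-sums : length sums ≡ suc (triangle (length xs))
  length-sums = trans (length-chain 0ℤ [] 0ℤ (reverse xs))
    (cong suc (trans (ℕ.+-identityʳ _) (cong triangle (length-reverse xs))))
  sums↑ : AllPairs _<_ sums
  sums↑ = chain-sorted (reverse xs) ([] ∷ []) ((ℤ.≤-refl , ℤ.≤-refl) ∷ []) (AllPairs-reverse xs↑)
    (All-reverse (All.map (λ 0<e → ℤ.<⇒≤ 0<e , m<e⇒m-[e+e]<-m 0<e) 0<xs))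
  sums⊆ : sums ⊆ restrSignedSumset (length (0ℤ ∷ xs)) (0ℤ ∷ xs)
  sums⊆ x∈ with ∈-chain⁻ (reverse xs) (here refl) x∈
  ... | _ , _ , here refl , p , refl =
    ∈-deduplicate⁺ _≟_ (SignedSum⇒∈signedSums (+∷_ {0ℤ} (SignedSum-resp-↭ (↭-reverse xs) p)))

restrSignedSumset-gain : ∀ {c₂ c₃ r} → AllPairs _<_ (0ℤ ∷ c₂ ∷ c₃ ∷ r) → + 2 ∣ℤ c₂ → ¬ (+ 2 ∣ℤ c₃) →
  length (restrSignedSumset (suc (suc (length r))) (0ℤ ∷ c₂ ∷ r))
    ℕ.+ suc (triangle (suc (length r)) ℕ.+ 2 ℕ.* suc (suc (length r)))
  ℕ.≤ length (restrSignedSumset (suc (suc (length r))) (0ℤ ∷ c₂ ∷ c₃ ∷ r))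
restrSignedSumset-gain {c₂} {c₃} {r} ((0<c₂ ∷ _) ∷ (c₂<c₃ ∷ c₂<r) ∷ c₃r↑) c₂-even c₃-odd =
  begin
  length (restrSignedSumset h A₃) ℕ.+ suc (triangle (suc (length r)) ℕ.+ 2 ℕ.* h)
    ≡⟨ cong (length (restrSignedSumset h A₃) ℕ.+_) length-sums ⟨
  length (restrSignedSumset h A₃) ℕ.+ length sums
    ≤⟨ length-deduplicate-++-≤ _≟_ (AllPairs.map ℤ.<⇒≢ sums↑) A₃#sums (A₃⊑A h) sums⊆ ⟩
  length (restrSignedSumset h A) ∎
  where
  open ℕ.≤-Reasoning
  h = suc (suc (length r))
  A = 0ℤ ∷ c₂ ∷ c₃ ∷ r
  A₃ = 0ℤ ∷ c₂ ∷ r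
  ds = reverse (c₃ ∷ r)
  sums = chain (- c₂ ∷ 0ℤ ∷ c₂ ∷ []) c₂ ds
  length-sums : length sums ≡ suc (triangle (suc (length r)) ℕ.+ 2 ℕ.* h)
  length-sums = trans (length-chain (- c₂) (0ℤ ∷ c₂ ∷ []) c₂ ds)
    (cong (λ n → suc (triangle n ℕ.+ 2 ℕ.* suc n)) (length-reverse (c₃ ∷ r)))
  -c₂<0 : - c₂ < 0ℤ
  -c₂<0 = ℤ.neg-mono-< 0<c₂
  sums↑ : AllPairs _<_ sums
  sums↑ = chain-sorted ds
    ((-c₂<0 ∷ ℤ.<-trans -c₂<0 0<c₂ ∷ []) ∷ (0<c₂ ∷ []) ∷ [] ∷ [])
    ((ℤ.≤-refl , ℤ.<⇒≤ (ℤ.<-trans -c₂<0 0<c₂)) ∷ (ℤ.<⇒≤ -c₂<0 , ℤ.<⇒≤ 0<c₂)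
      ∷ (ℤ.<⇒≤ (ℤ.<-trans -c₂<0 0<c₂) , ℤ.≤-refl) ∷ [])
    (AllPairs-reverse c₃r↑)
    (All-reverse (All.map (λ c₂<e → ℤ.<⇒≤ (ℤ.<-trans 0<c₂ c₂<e) , m<e⇒m-[e+e]<-m c₂<e) (c₂<c₃ ∷ c₂<r)))
  classify : ∀ {x} → x ∈ sums → SignedSum (c₂ ∷ c₃ ∷ r) x ⊎ SignedSum (0ℤ ∷ c₃ ∷ r) x
  classify x∈ with ∈-chain⁻ ds (there (there (here refl))) x∈
  ... | _ , _ , here refl , p , refl = inj₁ (-∷ SignedSum-resp-↭ (↭-reverse (c₃ ∷ r)) p)
  ... | _ , _ , there (here refl) , p , refl = inj₂ (+∷ SignedSum-resp-↭ (↭-reverse (c₃ ∷ r)) p)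
  ... | _ , _ , there (there (here refl)) , p , refl = inj₁ (+∷ SignedSum-resp-↭ (↭-reverse (c₃ ∷ r)) p)
  A₃⊑A : A₃ ⊑ A
  A₃⊑A = ⊑-∷⁺ʳ 0ℤ (⊑-∷⁺ʳ c₂ (xs⊑x∷xs r c₃))
  sums⊆ : sums ⊆ signedSums h A
  sums⊆ x∈ with classify x∈
  ... | inj₁ p = xs⊑x∷xs (c₂ ∷ c₃ ∷ r) 0ℤ h (SignedSum⇒∈signedSums p)
  ... | inj₂ p = ⊑-∷⁺ʳ 0ℤ (xs⊑x∷xs (c₃ ∷ r) c₂) h (SignedSum⇒∈signedSums p)
  dropping-0 : ∀ c₂ c₃ t → (c₂ + (c₃ + t)) - (0ℤ + (c₂ + t)) ≡ c₃
  dropping-0 = solve-∀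
  dropping-c₂ : ∀ c₂ c₃ t → (0ℤ + (c₃ + t)) - (0ℤ + (c₂ + t)) + c₂ ≡ c₃
  dropping-c₂ = solve-∀
  A₃#sums : Disjoint (signedSums h A₃) sums
  A₃#sums (u∈ , u∈sums) with ∈signedSums⇒SignedSum A₃ u∈ | classify u∈sums
  ... | p | inj₁ q = c₃-odd (subst (+ 2 ∣ℤ_) (dropping-0 c₂ c₃ (total r)) (SignedSum-common⇒even q p))
  ... | p | inj₂ q = c₃-odd (subst (+ 2 ∣ℤ_) (dropping-c₂ c₂ c₃ (total r))
                             (∣m∣n⇒∣m+n (SignedSum-common⇒even q p) c₂-even))

card-bounds : ∀ n {u v} → suc (triangle n) ℕ.≤ u → u ℕ.+ suc (triangle n ℕ.+ 2 ℕ.* suc n) ℕ.≤ v →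
  (u ℕ.+ (suc n ℕ.* (suc n ℕ.+ 1)) ℕ./ 2 ℕ.+ suc n ℕ.+ 1 ℕ.≤ v) × (suc n ℕ.^ 2 ℕ.+ suc n ℕ.+ 2 ℕ.≤ v)
card-bounds n {u} {v} 1+t≤u gain = gain-bound , square-bound
  where
  open ℕ.≤-Reasoning
  regroup : ∀ u t n → u ℕ.+ (suc n ℕ.+ t) ℕ.+ suc n ℕ.+ 1 ≡ u ℕ.+ suc (t ℕ.+ 2 ℕ.* suc n)
  regroup = ℕ-solve-∀
  gain-bound : u ℕ.+ (suc n ℕ.* (suc n ℕ.+ 1)) ℕ./ 2 ℕ.+ suc n ℕ.+ 1 ℕ.≤ v
  gain-bound = begin
    u ℕ.+ (suc n ℕ.* (suc n ℕ.+ 1)) ℕ./ 2 ℕ.+ suc n ℕ.+ 1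
      ≡⟨ cong (λ t → u ℕ.+ t ℕ.+ suc n ℕ.+ 1) (triangle-half (suc n)) ⟩
    u ℕ.+ (suc n ℕ.+ triangle n) ℕ.+ suc n ℕ.+ 1    ≡⟨ regroup u (triangle n) n ⟩
    u ℕ.+ suc (triangle n ℕ.+ 2 ℕ.* suc n)          ≤⟨ gain ⟩
    v                                               ∎
  square-bound : suc n ℕ.^ 2 ℕ.+ suc n ℕ.+ 2 ℕ.≤ v
  square-bound = begin
    suc n ℕ.^ 2 ℕ.+ suc n ℕ.+ 2                            ≡⟨ triangle+triangle n ⟩
    suc (triangle n) ℕ.+ suc (triangle n ℕ.+ 2 ℕ.* suc n)  ≤⟨ ℕ.+-monoˡ-≤ _ 1+t≤u ⟩
    u ℕ.+ suc (triangle n ℕ.+ 2 ℕ.* suc n)                 ≤⟨ gain ⟩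
    v                                                      ∎

h≡|A₃| : ∀ {h} a₂ rest → length rest ℕ.+ 3 ≡ h ℕ.+ 1 → h ≡ length (map +_ (0 ∷ a₂ ∷ rest))
h≡|A₃| {h} a₂ rest |rest|+3≡h+1 =
  trans (ℕ.suc-injective (trans (ℕ.+-comm 1 h) (trans (sym |rest|+3≡h+1) (ℕ.+-comm (length rest) 3))))
        (sym (length-map +_ (0 ∷ a₂ ∷ rest)))

lemma2p8 : (h : ℕ) → 3 ℕ.≤ h → (a₂ a₃ : ℕ) → (rest : List ℕ) →
    length rest ℕ.+ 3 ≡ h ℕ.+ 1 →
    Linked ℕ._<_ (0 ∷ a₂ ∷ a₃ ∷ rest) →
    ¬ (2 ∣ a₃) → 2 ∣ a₂ →
    (card h (0 ∷ a₂ ∷ rest) ℕ.+ (h ℕ.* (h ℕ.+ 1)) ℕ./ 2 ℕ.+ h ℕ.+ 1 ℕ.≤ card h (0 ∷ a₂ ∷ a₃ ∷ rest))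
    × (h ℕ.^ 2 ℕ.+ h ℕ.+ 2 ℕ.≤ card h (0 ∷ a₂ ∷ a₃ ∷ rest))
lemma2p8 h _ a₂ a₃ rest |rest|+3≡h+1 A↑ a₃-odd a₂-even rewrite h≡|A₃| a₂ rest |rest|+3≡h+1 =
  card-bounds (suc (length (map +_ rest)))
    (triangle<restrSignedSumset (AllPairs-drop-third A↑ℤ))
    (restrSignedSumset-gain A↑ℤ (∣ᵤ⇒∣ a₂-even) (a₃-odd ∘ ∣⇒∣ᵤ))
  where
  A↑ℤ : AllPairs _<_ (0ℤ ∷ + a₂ ∷ + a₃ ∷ map +_ rest)
  A↑ℤ = AllPairs.map⁺ (AllPairs.map ℤ.+<+ (Linked⇒AllPairs ℕ.<-trans A↑))
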